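{- Let $H$ be a finite abelian group of exponent $2$, let $\mathcal{A}=(A_h)_{h\in H}$ be a family on $H$, and let $\gamma$ be a non-trivial character of $H$. Then there is a subgroup $H' \le H$ of index $2$ and a family $\mathcal{A}'$ on $H'$ such that \[ \Lambda(\mathcal{A}) \ge 2^{ -4}\Lambda(\mathcal{A}') \quad\text{and}\quad \mathbb{P}_{H'}(\mathcal{A}') \ge \mathbb{P}_H(\mathcal{A}) + |\widehat{f_{\mathcal{A}}}(\gamma)|. \]
   Context: For a finite abelian group $H$ of exponent $2$: $\mathbb{E}_{x\in X}$ denotes $\frac1{|X|}\sum_{x\in X}$, $\mathbb{P}_H(X) := |X|/|H|$ for $X\subset H$, $\widehat{f}(\gamma) := \mathbb{E}_{x\in H}f(x)\overline{\gamma(x)}$ for characters $\gamma$ of $H$, $\langle f,g\rangle_{L^2(H)} := \mathbb{E}_{x\in H}f(x)\overline{g(x)}$, $(f\ast g)(x) := \mathbb{E}_{y\in H}f(y)g(x-y)$, and $\tau_h f(x) := f(x+h)$. A family on $H$ is a vector $\mathcal{A}=(A_h)_{h\in H}$ with each $A_h\subset H$; its density function is $f_{\mathcal{A}}(h) := \mathbb{P}_H(A_h)$, its density is $\mathbb{P}_H(\mathcal{A}) := \mathbb{E}_{h\in H}f_{\mathcal{A}}(h)$, and \[ \Lambda(\mathcal{A}) := \mathbb{E}_{h\in H}\langle \tau_h(1_{A_h}\ast 1_{A_h}), f_{\mathcal{A}}\rangle_{L^2(H)}, \] equivalently $|H|^4\Lambda(\mathcal{A})$ is the number of quadruples $(a,a',y,h)$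 with $a,a'\in A_h$ and $y\in A_{a+a'-h}$. For a subgroup $H'$, families on $H'$ and the quantities $\mathbb{P}_{H'}(\cdot)$, $\Lambda(\cdot)$ are defined in the same way with $H'$ in place of $H$. -}

module Defs where

open import Data.Bool using (Bool; true; false; _∧_; _xor_)
open import Data.Nat as ℕ using (ℕ; zero; suc; _^_)
open import Data.Integer as ℤ using (ℤ; +_)
open import Data.Rational as ℚ using (ℚ; 0ℚ)
open import Data.Vec using (Vec; []; _∷_; zipWith; replicate)
open import Data.List as List using (List; []; _∷_; _++_)
open import Data.Product using (∃)
open import Relation.Binary.PropositionalEquality using (_≡_; _≢_)
open import Data.Sum using (_⊎_)

-- The ambient group: H = (ℤ/2)^n, every finite abelian group of exponent 2
-- is isomorphic to one of these.  Elements are bit-vectors, addition is xor.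
H : ℕ → Set
H n = Vec Bool n

infixl 6 _⊕_
_⊕_ : ∀ {n} → H n → H n → H n
_⊕_ = zipWith _xor_

0H : ∀ {n} → H n
0H = replicate _ false

allH : ∀ n → List (H n)
allH zero    = [] ∷ []
allH (suc n) = List.map (false ∷_) (allH n) ++ List.map (true ∷_) (allH n)

sumℕ : ∀ {n} → (H n → ℕ) → ℕ
sumℕ f = List.foldr ℕ._+_ 0 (List.map f (allH _))

sumℤ : ∀ {n} → (H n → ℤ) → ℤ
sumℤ f = List.foldr ℤ._+_ (+ 0) (List.map f (allH _))

ind : Bool → ℕ
ind true  = 1
ind false = 0

-- division with the convention p / 0 = 0 (never used with a zero denominator below)
_/ℚ_ : ℤ → ℕ → ℚ
p /ℚ zero    = 0ℚ
p /ℚ suc d   = p ℚ./ suc d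

SubsetH : ℕ → Set
SubsetH n = H n → Bool

fullH : ∀ {n} → SubsetH n
fullH _ = true

-- S is a subgroup (contains 0 and closed under +; inverses are automatic in exponent 2)
IsSubgroup : ∀ {n} → SubsetH n → Set
IsSubgroup S = (S 0H ≡ true) × (∀ x y → S x ≡ true → S y ≡ true → S (x ⊕ y) ≡ true)
  where open import Data.Product using (_×_)

card : ∀ {n} → SubsetH n → ℕ
card S = sumℕ (λ x → ind (S x))

-- A family: A h x = true  means  x ∈ A_h.  A family on a subgroup S is read
-- off by restriction: (A_h ∩ S)_{h ∈ S}.  Every family on S arises this way.
Family : ℕ → Set
Family n = H n → H n → Bool

famCount : ∀ {n} → SubsetH n → Family n → ℕ
famCount S A = sumℕ λ h → sumℕ λ x → ind (S h ∧ S x ∧ A h x)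

-- P_S(A) = E_{h∈S} P_S(A_h) = famCount / |S|^2
density : ∀ {n} → SubsetH n → Family n → ℚ
density S A = (+ famCount S A) /ℚ (card S ^ 2)

ΛCount : ∀ {n} → SubsetH n → Family n → ℕ
ΛCount S A =
  sumℕ λ h → sumℕ λ a → sumℕ λ a' → sumℕ λ y →
    ind (S h ∧ S a ∧ S a' ∧ S y ∧ A h a ∧ A h a' ∧ A (a ⊕ a' ⊕ h) y)

Λ : ∀ {n} → SubsetH n → Family n → ℚ
Λ S A = (+ ΛCount S A) /ℚ (card S ^ 4)

-- A character of H n: a homomorphism into the multiplicative group of C.
-- Since H has exponent 2 its values lie in {1,-1}, so we take it ℤ-valued.
IsCharacter : ∀ {n} → (H n → ℤ) → Set
IsCharacter γ = (∀ x → (γ x ≡ + 1) ⊎ (γ x ≡ ℤ.- (+ 1)))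
              × (∀ x y → γ (x ⊕ y) ≡ γ x ℤ.* γ y)
  where open import Data.Product using (_×_)

NonTrivial : ∀ {n} → (H n → ℤ) → Set
NonTrivial γ = ∃ λ x → γ x ≢ + 1

-- \hat f_A(γ) = E_x f_A(x) \overline{γ(x)} = (Σ_x γ(x) |A_x|) / |H|^2   (γ real)
fourierDensity : ∀ {n} → Family n → (H n → ℤ) → ℚ
fourierDensity {n} A γ =
  (sumℤ λ x → γ x ℤ.* (+ sumℕ (λ y → ind (A x y)))) /ℚ (card (fullH {n}) ^ 2)

{-# OPTIONS --safe #-}
-- H' is the kernel of γ; it has index 2, its other coset being H' ⊕ t for any t with γ t = -1.
-- Let M₀, M₁ be the total sizes of the A_h with h in H' and in H' ⊕ t.  The numerator of
-- P_H(A) + |f̂_A(γ)| is then M₀ + M₁ + |M₀ - M₁| = 2 max(M₀, M₁).  Pick the heavier coset c,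
-- and for each k the coset s_k of H' containing at least half of A_k; the family
-- A'_h = (A_{h ⊕ c} ⊕ s_{h ⊕ c}) ∩ H' on H' then has total size at least max(M₀, M₁)/2,
-- which is the density bound.  Translating by these shifts, (h, a, a', y) ↦
-- (h ⊕ c, a ⊕ s, a' ⊕ s, y ⊕ s') maps configurations counted by Λ(A') injectively to
-- configurations counted by Λ(A), because a common shift of a and a' cancels in a ⊕ a';
-- the factor 2⁻⁴ is the change of normalisation from |H'|⁴ to |H|⁴.
module Submission where

open import Defs
open import Data.Nat.Base using (ℕ)
open import Data.Integer.Base using (ℤ)
open import Data.Bool.Base using (Bool; true; false; not; _∧_)
open import Data.Bool.Properties using (xor-assoc; xor-comm; xor-identityˡ; xor-identityʳ; xor-same; not-involutive)
open import Data.Vec.Base using ([]; _∷_)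
open import Data.Vec.Relation.Binary.Pointwise.Inductive using (Pointwise-≡⇒≡; zipWith-assoc; zipWith-comm; zipWith-identityˡ; zipWith-identityʳ)
open import Data.List.Base using ([]; _∷_; map; foldr)
open import Data.List.Properties using (map-cong)
open import Data.Product.Base using (_,_; proj₁; proj₂)
open import Data.Sum.Base using (_⊎_; inj₁; inj₂)
open import Relation.Nullary using (yes; no; does; contradiction)
open import Relation.Nullary.Decidable using (dec-true)
open import Relation.Binary.PropositionalEquality

⊕-assoc : ∀ {n} (x y z : H n) → (x ⊕ y) ⊕ z ≡ x ⊕ (y ⊕ z)
⊕-assoc x y z = Pointwise-≡⇒≡ (zipWith-assoc xor-assoc x y z)

⊕-comm : ∀ {n} (x y : H n) → x ⊕ y ≡ y ⊕ x
⊕-comm x y = Pointwise-≡⇒≡ (zipWith-comm xor-comm x y)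

⊕-identityˡ : ∀ {n} (x : H n) → 0H ⊕ x ≡ x
⊕-identityˡ x = Pointwise-≡⇒≡ (zipWith-identityˡ xor-identityˡ x)

⊕-identityʳ : ∀ {n} (x : H n) → x ⊕ 0H ≡ x
⊕-identityʳ x = Pointwise-≡⇒≡ (zipWith-identityʳ xor-identityʳ x)

⊕-self : ∀ {n} (x : H n) → x ⊕ x ≡ 0H
⊕-self []      = refl
⊕-self (b ∷ x) = cong₂ _∷_ (xor-same b) (⊕-self x)

⊕-translate-cancel : ∀ {n} (x y t : H n) → (x ⊕ t) ⊕ (y ⊕ t) ≡ x ⊕ y
⊕-translate-cancel x y t = begin
  (x ⊕ t) ⊕ (y ⊕ t)  ≡⟨ ⊕-assoc x t (y ⊕ t) ⟩
  x ⊕ (t ⊕ (y ⊕ t))  ≡⟨ cong (λ z → x ⊕ (t ⊕ z)) (⊕-comm y t) ⟩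
  x ⊕ (t ⊕ (t ⊕ y))  ≡⟨ cong (x ⊕_) (sym (⊕-assoc t t y)) ⟩
  x ⊕ ((t ⊕ t) ⊕ y)  ≡⟨ cong (λ z → x ⊕ (z ⊕ y)) (⊕-self t) ⟩
  x ⊕ (0H ⊕ y)       ≡⟨ cong (x ⊕_) (⊕-identityˡ y) ⟩
  x ⊕ y              ∎
  where open ≡-Reasoning

module Counting where
  open import Data.Nat.Base
  open import Data.Nat.Properties
  open import Data.Nat.ListAction using (sum)
  open import Data.List.Base using (_++_)
  open import Data.List.Properties using (map-++; map-∘)
  open import Data.Nat.ListAction.Properties using (sum-++)
  open import Algebra.Properties.CommutativeSemigroup +-commutativeSemigroup using (interchange)

  sum-map-mono : ∀ {A : Set} {f g : A → ℕ} → (∀ x → f x ≤ g x) → ∀ xs → sum (map f xs) ≤ sum (map g xs)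
  sum-map-mono f≤g []       = z≤n
  sum-map-mono f≤g (x ∷ xs) = +-mono-≤ (f≤g x) (sum-map-mono f≤g xs)

  sum-map-+ : ∀ {A : Set} (f g : A → ℕ) xs → sum (map (λ x → f x + g x) xs) ≡ sum (map f xs) + sum (map g xs)
  sum-map-+ f g []       = refl
  sum-map-+ f g (x ∷ xs) = begin
    f x + g x + sum (map (λ x → f x + g x) xs)      ≡⟨ cong ((f x + g x) +_) (sum-map-+ f g xs) ⟩
    f x + g x + (sum (map f xs) + sum (map g xs))   ≡⟨ interchange (f x) (g x) _ _ ⟩
    f x + sum (map f xs) + (g x + sum (map g xs))   ∎
    where open ≡-Reasoning

  sum-map-* : ∀ {A : Set} k (f : A → ℕ) xs → sum (map (λ x → k * f x) xs) ≡ k * sum (map f xs)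
  sum-map-* k f []       = sym (*-zeroʳ k)
  sum-map-* k f (x ∷ xs) = begin
    k * f x + sum (map (λ x → k * f x) xs)  ≡⟨ cong ((k * f x) +_) (sum-map-* k f xs) ⟩
    k * f x + k * sum (map f xs)            ≡⟨ *-distribˡ-+ k (f x) _ ⟨
    k * (f x + sum (map f xs))              ∎
    where open ≡-Reasoning

  sumℕ-cong : ∀ {n} {f g : H n → ℕ} → (∀ x → f x ≡ g x) → sumℕ f ≡ sumℕ g
  sumℕ-cong f≗g = cong sum (map-cong f≗g (allH _))

  sumℕ-split : ∀ {n} (f : H (suc n) → ℕ) → sumℕ f ≡ sumℕ (λ x → f (false ∷ x)) + sumℕ (λ x → f (true ∷ x))
  sumℕ-split {n} f = begin
    sum (map f (map (false ∷_) (allH n) ++ map (true ∷_) (allH n)))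
      ≡⟨ cong sum (map-++ f (map (false ∷_) (allH n)) _) ⟩
    sum (map f (map (false ∷_) (allH n)) ++ map f (map (true ∷_) (allH n)))
      ≡⟨ sum-++ (map f (map (false ∷_) (allH n))) _ ⟩
    sum (map f (map (false ∷_) (allH n))) + sum (map f (map (true ∷_) (allH n)))
      ≡⟨ cong₂ _+_ (cong sum (sym (map-∘ (allH n)))) (cong sum (sym (map-∘ (allH n)))) ⟩
    sumℕ (λ x → f (false ∷ x)) + sumℕ (λ x → f (true ∷ x))
      ∎
    where open ≡-Reasoning

  sumℕ-⊕ : ∀ {n} (f : H n → ℕ) (t : H n) → sumℕ (λ x → f (x ⊕ t)) ≡ sumℕ f
  sumℕ-⊕ {zero}  f []      = refl
  sumℕ-⊕ {suc n} f (b ∷ t) = begin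
    sumℕ (λ x → f (x ⊕ (b ∷ t)))
      ≡⟨ sumℕ-split (λ x → f (x ⊕ (b ∷ t))) ⟩
    sumℕ (λ x → f (b ∷ x ⊕ t)) + sumℕ (λ x → f (not b ∷ x ⊕ t))
      ≡⟨ cong₂ _+_ (sumℕ-⊕ (λ x → f (b ∷ x)) t) (sumℕ-⊕ (λ x → f (not b ∷ x)) t) ⟩
    sumℕ (λ x → f (b ∷ x)) + sumℕ (λ x → f (not b ∷ x))
      ≡⟨ halves b ⟩
    sumℕ f
      ∎
    where
    open ≡-Reasoning
    halves : ∀ b → sumℕ (λ x → f (b ∷ x)) + sumℕ (λ x → f (not b ∷ x)) ≡ sumℕ f
    halves false = sym (sumℕ-split f)
    halves true  = trans (+-comm (sumℕ (λ x → f (true ∷ x))) _) (sym (sumℕ-split f))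

  sumℕ-≤-⊕ : ∀ {n} {f g : H n → ℕ} (t : H n) → (∀ x → f x ≤ g (x ⊕ t)) → sumℕ f ≤ sumℕ g
  sumℕ-≤-⊕ {g = g} t f≤g∘⊕ = ≤-trans (sum-map-mono f≤g∘⊕ (allH _)) (≤-reflexive (sumℕ-⊕ g t))

  card-fullH : ∀ n → card (fullH {n}) ≡ 2 ^ n
  card-fullH zero    = refl
  card-fullH (suc n) = begin
    card (fullH {suc n})                    ≡⟨ sumℕ-split {n} (λ _ → 1) ⟩
    card (fullH {n}) + card (fullH {n})     ≡⟨ cong₂ _+_ (card-fullH n) (card-fullH n) ⟩
    2 ^ n + 2 ^ n                           ≡⟨ cong (2 ^ n +_) (+-identityʳ (2 ^ n)) ⟨
    2 ^ suc n                               ∎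
    where open ≡-Reasoning

  argmax : ∀ {A : Set} → (A → ℕ) → A → A → A
  argmax f x y with f y ≤? f x
  ... | yes _ = x
  ... | no  _ = y

  argmax-spec : ∀ {A : Set} (f : A → ℕ) x y → f (argmax f x y) ≡ f x ⊔ f y
  argmax-spec f x y with f y ≤? f x
  ... | yes fy≤fx = sym (m≥n⇒m⊔n≡m fy≤fx)
  ... | no  fy≰fx = sym (m≤n⇒m⊔n≡n (<⇒≤ (≰⇒> fy≰fx)))

  +≤2*⊔ : ∀ m n → m + n ≤ 2 * (m ⊔ n)
  +≤2*⊔ m n = begin
    m + n              ≤⟨ +-mono-≤ (m≤m⊔n m n) (m≤m⊔n n m) ⟩
    (m ⊔ n) + (n ⊔ m)  ≡⟨ cong ((m ⊔ n) +_) (trans (⊔-comm n m) (sym (+-identityʳ (m ⊔ n)))) ⟩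
    2 * (m ⊔ n)        ∎
    where open ≤-Reasoning

  ind-∧-≤ : ∀ b c → ind (b ∧ c) ≤ ind c
  ind-∧-≤ true  c = ≤-refl
  ind-∧-≤ false c = z≤n

  ind-∧-split : ∀ b c → ind (b ∧ c) + ind (not b ∧ c) ≡ ind c
  ind-∧-split true  c = +-identityʳ (ind c)
  ind-∧-split false c = refl

  ind-*-split : ∀ b m → ind b * m + ind (not b) * m ≡ m
  ind-*-split true  m = trans (+-identityʳ (1 * m)) (*-identityˡ m)
  ind-*-split false m = +-identityʳ m

open Counting

module IntegerSums where
  open import Data.Nat.Base using (ℕ)
  open import Data.Nat.ListAction using (sum)
  open import Data.Integer.Base using (ℤ; +_; _+_; _-_)
  open import Data.Integer.Properties using (pos-+)
  open import Data.Integer.Tactic.RingSolver using (solve-∀)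

  sumℤ-⊖ : ∀ {n} (f g : H n → ℕ) → sumℤ (λ x → + f x - + g x) ≡ + sumℕ f - + sumℕ g
  sumℤ-⊖ {n} f g = go (allH n)
    where
    go : ∀ xs → foldr _+_ (+ 0) (map (λ x → + f x - + g x) xs) ≡ + sum (map f xs) - + sum (map g xs)
    go []       = refl
    go (x ∷ xs) rewrite go xs | pos-+ (f x) (sum (map f xs)) | pos-+ (g x) (sum (map g xs)) =
      interchange (+ f x) (+ g x) (+ sum (map f xs)) (+ sum (map g xs))
      where
      interchange : ∀ a b c d → a - b + (c - d) ≡ a + c - (b + d)
      interchange = solve-∀

  sumℤ-cong : ∀ {n} {f g : H n → ℤ} → (∀ x → f x ≡ g x) → sumℤ f ≡ sumℤ g
  sumℤ-cong f≗g = cong (foldr _+_ (+ 0)) (map-cong f≗g (allH _))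

open IntegerSums

module Character {n : ℕ} (γ : H n → ℤ) (χ : IsCharacter γ) where
  import Data.Nat.Base as ℕ
  import Data.Nat.Properties as ℕ
  open import Data.Integer.Base using (+_; -_; _+_; _-_; _*_)
  open import Data.Integer.Properties using (_≟_; *-identityˡ; +-identityˡ; +-identityʳ; -1*i≡-i)

  isOne : ℤ → Bool
  isOne g = does (g ≟ + 1)

  isOne-flip : ∀ {g} → (g ≡ + 1) ⊎ (g ≡ - + 1) → isOne (g * - + 1) ≡ not (isOne g)
  isOne-flip (inj₁ refl) = refl
  isOne-flip (inj₂ refl) = refl

  ±1*-split : ∀ {g} → (g ≡ + 1) ⊎ (g ≡ - + 1) → ∀ m →
    g * + m ≡ + (ind (isOne g) ℕ.* m) - + (ind (not (isOne g)) ℕ.* m)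
  ±1*-split (inj₁ refl) m = begin
    + 1 * + m                     ≡⟨ *-identityˡ (+ m) ⟩
    + m                           ≡⟨ cong +_ (ℕ.*-identityˡ m) ⟨
    + (1 ℕ.* m)                   ≡⟨ +-identityʳ (+ (1 ℕ.* m)) ⟨
    + (1 ℕ.* m) - + (0 ℕ.* m)     ∎
    where open ≡-Reasoning
  ±1*-split (inj₂ refl) m = begin
    - + 1 * + m                   ≡⟨ -1*i≡-i (+ m) ⟩
    - + m                         ≡⟨ cong (λ k → - + k) (ℕ.*-identityˡ m) ⟨
    - + (1 ℕ.* m)                 ≡⟨ +-identityˡ (- + (1 ℕ.* m)) ⟨
    + (0 ℕ.* m) - + (1 ℕ.* m)     ∎
    where open ≡-Reasoning

  γ-±1 : ∀ x → (γ x ≡ + 1) ⊎ (γ x ≡ - + 1)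
  γ-±1 = proj₁ χ

  γ-⊕ : ∀ x y → γ (x ⊕ y) ≡ γ x * γ y
  γ-⊕ = proj₂ χ

  γ-0H : γ 0H ≡ + 1
  γ-0H with γ-±1 0H
  ... | inj₁ γ0≡1  = γ0≡1
  ... | inj₂ γ0≡-1 = contradiction -1≡1 λ ()
    where
    -1≡1 : - + 1 ≡ + 1
    -1≡1 = begin
      - + 1            ≡⟨ γ0≡-1 ⟨
      γ 0H             ≡⟨ cong γ (⊕-self 0H) ⟨
      γ (0H ⊕ 0H)      ≡⟨ γ-⊕ 0H 0H ⟩
      γ 0H * γ 0H      ≡⟨ cong₂ _*_ γ0≡-1 γ0≡-1 ⟩
      + 1              ∎
      where open ≡-Reasoning

  γ≢1⇒γ≡-1 : ∀ {x} → γ x ≢ + 1 → γ x ≡ - + 1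
  γ≢1⇒γ≡-1 {x} γx≢1 with γ-±1 x
  ... | inj₁ γx≡1  = contradiction γx≡1 γx≢1
  ... | inj₂ γx≡-1 = γx≡-1

  ker : SubsetH n
  ker x = isOne (γ x)

  ker-sound : ∀ {x} → ker x ≡ true → γ x ≡ + 1
  ker-sound {x} with γ x ≟ + 1
  ... | yes γx≡1 = λ _ → γx≡1
  ... | no  _    = λ ()

  ker-isSubgroup : IsSubgroup ker
  ker-isSubgroup = dec-true (γ 0H ≟ + 1) γ-0H , closed
    where
    closed : ∀ x y → ker x ≡ true → ker y ≡ true → ker (x ⊕ y) ≡ true
    closed x y x∈ker y∈ker =
      dec-true (γ (x ⊕ y) ≟ + 1) (trans (γ-⊕ x y) (cong₂ _*_ (ker-sound x∈ker) (ker-sound y∈ker)))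

  ker-⊕ : ∀ {t} → γ t ≡ - + 1 → ∀ x → ker (x ⊕ t) ≡ not (ker x)
  ker-⊕ {t} γt≡-1 x = trans (cong isOne (trans (γ-⊕ x t) (cong (γ x *_) γt≡-1))) (isOne-flip (γ-±1 x))

  γ*-split : ∀ x m → γ x * + m ≡ + (ind (ker x) ℕ.* m) - + (ind (not (ker x)) ℕ.* m)
  γ*-split x = ±1*-split (γ-±1 x)

module IndexTwo {n : ℕ} (S : SubsetH n) (t : H n) (S-⊕ : ∀ x → S (x ⊕ t) ≡ not (S x)) where
  open import Data.Nat.Base
  open import Data.Nat.Properties

  sumℕ-complement : (g : Bool → H n → ℕ) → sumℕ (λ x → g (not (S x)) x) ≡ sumℕ (λ x → g (S x) (x ⊕ t))
  sumℕ-complement g = begin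
    sumℕ (λ x → g (not (S x)) x)                    ≡⟨ sumℕ-⊕ (λ x → g (not (S x)) x) t ⟨
    sumℕ (λ x → g (not (S (x ⊕ t))) (x ⊕ t))        ≡⟨ sumℕ-cong (λ x → cong (λ b → g b (x ⊕ t)) S⊕t-flip) ⟩
    sumℕ (λ x → g (S x) (x ⊕ t))                    ∎
    where
    open ≡-Reasoning
    S⊕t-flip : ∀ {x} → not (S (x ⊕ t)) ≡ S x
    S⊕t-flip {x} = trans (cong not (S-⊕ x)) (not-involutive (S x))

  card-index-two : 2 * card S ≡ card (fullH {n})
  card-index-two = begin
    2 * card S                                    ≡⟨ cong (card S +_) (+-identityʳ (card S)) ⟩
    card S + card S                               ≡⟨ cong (card S +_) (sumℕ-complement (λ b _ → ind b)) ⟨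
    card S + sumℕ (λ x → ind (not (S x)))         ≡⟨ sum-map-+ (λ x → ind (S x)) (λ x → ind (not (S x))) (allH n) ⟨
    sumℕ (λ x → ind (S x) + ind (not (S x)))      ≡⟨ sumℕ-cong (λ x → ind-+-not (S x)) ⟩
    card (fullH {n})                              ∎
    where
    open ≡-Reasoning
    ind-+-not : ∀ b → ind b + ind (not b) ≡ 1
    ind-+-not true  = refl
    ind-+-not false = refl

module RationalArithmetic where
  open import Data.Nat.Base as ℕ using (suc)
  import Data.Nat.Properties as ℕ
  import Data.Nat.Tactic.RingSolver as ℕ
  open import Data.Integer.Base as ℤ using (+_)
  import Data.Integer.Properties as ℤ
  open import Data.Integer.Tactic.RingSolver using (solve-∀)
  open import Data.Rational.Base
  open import Data.Rational.Properties
  open import Data.Rational.Unnormalised.Base as ℚᵘ using (*≡*; *≤*)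
  import Data.Rational.Unnormalised.Properties as ℚᵘ

  toℚᵘ-/ : ∀ p m .{{_ : ℕ.NonZero m}} → toℚᵘ (p / m) ℚᵘ.≃ p ℚᵘ./ m
  toℚᵘ-/ p (suc m) = toℚᵘ-fromℚᵘ (ℚᵘ.mkℚᵘ p m)

  /-+-/ : ∀ p q m .{{_ : ℕ.NonZero m}} → p / m + q / m ≡ (p ℤ.+ q) / m
  /-+-/ p q m@(suc _) = toℚᵘ-injective (begin
    toℚᵘ (p / m + q / m)              ≈⟨ toℚᵘ-homo-+ (p / m) (q / m) ⟩
    toℚᵘ (p / m) ℚᵘ.+ toℚᵘ (q / m)    ≈⟨ ℚᵘ.+-cong (toℚᵘ-/ p m) (toℚᵘ-/ q m) ⟩
    p ℚᵘ./ m ℚᵘ.+ q ℚᵘ./ m            ≈⟨ *≡* (trans (distrib p q (+ m)) (cong ((p ℤ.+ q) ℤ.*_) (sym (ℤ.pos-* m m)))) ⟩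
    (p ℤ.+ q) ℚᵘ./ m                  ≈⟨ toℚᵘ-/ (p ℤ.+ q) m ⟨
    toℚᵘ ((p ℤ.+ q) / m)              ∎)
    where
    open ℚᵘ.≃-Reasoning
    distrib : ∀ p q d → (p ℤ.* d ℤ.+ q ℤ.* d) ℤ.* d ≡ (p ℤ.+ q) ℤ.* (d ℤ.* d)
    distrib = solve-∀

  -‿/ : ∀ p m .{{_ : ℕ.NonZero m}} → - (p / m) ≡ (ℤ.- p) / m
  -‿/ p m@(suc _) = toℚᵘ-injective (begin
    toℚᵘ (- (p / m))          ≈⟨ toℚᵘ-homo‿- (p / m) ⟩
    ℚᵘ.- toℚᵘ (p / m)         ≈⟨ ℚᵘ.-‿cong (toℚᵘ-/ p m) ⟩
    (ℤ.- p) ℚᵘ./ m            ≈⟨ toℚᵘ-/ (ℤ.- p) m ⟨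
    toℚᵘ ((ℤ.- p) / m)        ∎)
    where open ℚᵘ.≃-Reasoning

  /-*-/ : ∀ p q m n .{{_ : ℕ.NonZero m}} .{{_ : ℕ.NonZero n}} →
    (p / m) * (q / n) ≡ ((p ℤ.* q) / (m ℕ.* n)) {{ℕ.m*n≢0 m n}}
  /-*-/ p q m@(suc _) n@(suc _) = toℚᵘ-injective (begin
    toℚᵘ ((p / m) * (q / n))          ≈⟨ toℚᵘ-homo-* (p / m) (q / n) ⟩
    toℚᵘ (p / m) ℚᵘ.* toℚᵘ (q / n)    ≈⟨ ℚᵘ.*-cong (toℚᵘ-/ p m) (toℚᵘ-/ q n) ⟩
    (p ℤ.* q) ℚᵘ./ (m ℕ.* n)          ≈⟨ toℚᵘ-/ (p ℤ.* q) (m ℕ.* n) ⟨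
    toℚᵘ ((p ℤ.* q) / (m ℕ.* n))      ∎)
    where open ℚᵘ.≃-Reasoning

  +/-mono-≤ : ∀ {a b} m n .{{_ : ℕ.NonZero m}} .{{_ : ℕ.NonZero n}} → a ℕ.* n ℕ.≤ b ℕ.* m → + a / m ≤ + b / n
  +/-mono-≤ {a} {b} m@(suc _) n@(suc _) an≤bm = toℚᵘ-cancel-≤ (begin
    toℚᵘ (+ a / m)      ≃⟨ toℚᵘ-/ (+ a) m ⟩
    + a ℚᵘ./ m          ≤⟨ *≤* (subst₂ ℤ._≤_ (ℤ.pos-* a n) (ℤ.pos-* b m) (ℤ.+≤+ an≤bm)) ⟩
    + b ℚᵘ./ n          ≃⟨ toℚᵘ-/ (+ b) n ⟨
    toℚᵘ (+ b / n)      ∎)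
    where open ℚᵘ.≤-Reasoning

  p±q≤r⇒p+∣q∣≤r : ∀ p q r → p + q ≤ r → p - q ≤ r → p + ∣ q ∣ ≤ r
  p±q≤r⇒p+∣q∣≤r p q r p+q≤r p-q≤r with ∣p∣≡p∨∣p∣≡-p q
  ... | inj₁ ∣q∣≡q  = subst (λ x → p + x ≤ r) (sym ∣q∣≡q) p+q≤r
  ... | inj₂ ∣q∣≡-q = subst (λ x → p + x ≤ r) (sym ∣q∣≡-q) p-q≤r

  [2s]⁴≡16s⁴ : ∀ s → (2 ℕ.* s) ℕ.^ 4 ≡ 16 ℕ.* s ℕ.^ 4
  [2s]⁴≡16s⁴ = expanded
    where
    -- the ring solver does not read `_^_`, so the powers are unfolded by hand
    expanded : ∀ s → (2 ℕ.* s) ℕ.* ((2 ℕ.* s) ℕ.* ((2 ℕ.* s) ℕ.* ((2 ℕ.* s) ℕ.* 1)))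
                   ≡ 16 ℕ.* (s ℕ.* (s ℕ.* (s ℕ.* (s ℕ.* 1))))
    expanded = ℕ.solve-∀

  [2F+2F]s²≡F[2s]² : ∀ F s → (2 ℕ.* F ℕ.+ 2 ℕ.* F) ℕ.* s ℕ.^ 2 ≡ F ℕ.* (2 ℕ.* s) ℕ.^ 2
  [2F+2F]s²≡F[2s]² = expanded
    where
    expanded : ∀ F s → (2 ℕ.* F ℕ.+ 2 ℕ.* F) ℕ.* (s ℕ.* (s ℕ.* 1)) ≡ F ℕ.* ((2 ℕ.* s) ℕ.* ((2 ℕ.* s) ℕ.* 1))
    expanded = ℕ.solve-∀

  Λ-rescale : ∀ {X Y} s .{{_ : ℕ.NonZero s}} → X ℕ.≤ Y →
    ((+ 1) / 16) * ((+ X) /ℚ (s ℕ.^ 4)) ≤ (+ Y) /ℚ ((2 ℕ.* s) ℕ.^ 4)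
  Λ-rescale {X} {Y} s@(suc _) X≤Y = begin
    ((+ 1) / 16) * ((+ X) / s ℕ.^ 4)     ≡⟨ /-*-/ (+ 1) (+ X) 16 (s ℕ.^ 4) ⟩
    (+ 1 ℤ.* + X) / (16 ℕ.* s ℕ.^ 4)     ≡⟨ cong (_/ (16 ℕ.* s ℕ.^ 4)) (ℤ.*-identityˡ (+ X)) ⟩
    (+ X) / (16 ℕ.* s ℕ.^ 4)             ≤⟨ +/-mono-≤ {X} {Y} (16 ℕ.* s ℕ.^ 4) ((2 ℕ.* s) ℕ.^ 4) cross ⟩
    (+ Y) / (2 ℕ.* s) ℕ.^ 4              ∎
    where
    open ≤-Reasoning
    cross : X ℕ.* (2 ℕ.* s) ℕ.^ 4 ℕ.≤ Y ℕ.* (16 ℕ.* s ℕ.^ 4)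
    cross = subst (λ k → X ℕ.* (2 ℕ.* s) ℕ.^ 4 ℕ.≤ Y ℕ.* k) ([2s]⁴≡16s⁴ s) (ℕ.*-monoˡ-≤ ((2 ℕ.* s) ℕ.^ 4) X≤Y)

  density-rescale : ∀ {P Q F} s .{{_ : ℕ.NonZero s}} → P ℕ.≤ 2 ℕ.* F → Q ℕ.≤ 2 ℕ.* F →
    (+ (P ℕ.+ Q)) /ℚ ((2 ℕ.* s) ℕ.^ 2) + ∣ (+ P ℤ.- + Q) /ℚ ((2 ℕ.* s) ℕ.^ 2) ∣ ≤ (+ F) /ℚ (s ℕ.^ 2)
  density-rescale {P} {Q} {F} s@(suc _) P≤2F Q≤2F =
    p±q≤r⇒p+∣q∣≤r ((+ (P ℕ.+ Q)) / D) ((+ P ℤ.- + Q) / D) ((+ F) / s ℕ.^ 2)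
    (begin
      (+ (P ℕ.+ Q)) / D + (+ P ℤ.- + Q) / D           ≡⟨ /-+-/ (+ (P ℕ.+ Q)) (+ P ℤ.- + Q) D ⟩
      (+ (P ℕ.+ Q) ℤ.+ (+ P ℤ.- + Q)) / D             ≡⟨ cong (_/ D) (sum+diff P Q) ⟩
      (+ (P ℕ.+ P)) / D                               ≤⟨ doubled-≤ P≤2F ⟩
      (+ F) / s ℕ.^ 2                                 ∎)
    (begin
      (+ (P ℕ.+ Q)) / D - (+ P ℤ.- + Q) / D           ≡⟨ cong (_+_ ((+ (P ℕ.+ Q)) / D)) (-‿/ (+ P ℤ.- + Q) D) ⟩
      (+ (P ℕ.+ Q)) / D + (ℤ.- (+ P ℤ.- + Q)) / D     ≡⟨ /-+-/ (+ (P ℕ.+ Q)) (ℤ.- (+ P ℤ.- + Q)) D ⟩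
      (+ (P ℕ.+ Q) ℤ.+ ℤ.- (+ P ℤ.- + Q)) / D         ≡⟨ cong (_/ D) (sum-diff P Q) ⟩
      (+ (Q ℕ.+ Q)) / D                               ≤⟨ doubled-≤ Q≤2F ⟩
      (+ F) / s ℕ.^ 2                                 ∎)
    where
    open ≤-Reasoning
    D : ℕ
    D = (2 ℕ.* s) ℕ.^ 2
    doubled-≤ : ∀ {x} → x ℕ.≤ 2 ℕ.* F → (+ (x ℕ.+ x)) / D ≤ (+ F) / s ℕ.^ 2
    doubled-≤ {x} x≤2F = +/-mono-≤ {x ℕ.+ x} {F} D (s ℕ.^ 2) (ℕ.≤-trans
      (ℕ.*-monoˡ-≤ (s ℕ.^ 2) (ℕ.+-mono-≤ x≤2F x≤2F))
      (ℕ.≤-reflexive ([2F+2F]s²≡F[2s]² F s)))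
    sum+diff : ∀ P Q → + (P ℕ.+ Q) ℤ.+ (+ P ℤ.- + Q) ≡ + (P ℕ.+ P)
    sum+diff P Q rewrite ℤ.pos-+ P Q | ℤ.pos-+ P P = ring (+ P) (+ Q)
      where
      ring : ∀ p q → p ℤ.+ q ℤ.+ (p ℤ.- q) ≡ p ℤ.+ p
      ring = solve-∀
    sum-diff : ∀ P Q → + (P ℕ.+ Q) ℤ.+ ℤ.- (+ P ℤ.- + Q) ≡ + (Q ℕ.+ Q)
    sum-diff P Q rewrite ℤ.pos-+ P Q | ℤ.pos-+ Q Q = ring (+ P) (+ Q)
      where
      ring : ∀ p q → p ℤ.+ q ℤ.+ ℤ.- (p ℤ.- q) ≡ q ℤ.+ q
      ring = solve-∀

open RationalArithmetic

module Construction {n : ℕ} (A : Family n) (γ : H n → ℤ) (χ : IsCharacter γ) (γ≢1 : NonTrivial γ) where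
  open import Data.Nat.Base
  open import Data.Nat.Properties
  import Data.Integer.Base as ℤ
  import Data.Rational.Base as ℚ
  open Character γ χ public

  t : H n
  t = proj₁ γ≢1

  open IndexTwo ker t (ker-⊕ (γ≢1⇒γ≡-1 (proj₂ γ≢1))) public

  ∣A∣ : H n → ℕ
  ∣A∣ k = sumℕ (λ x → ind (A k x))

  ∣A∩coset∣ : H n → H n → ℕ
  ∣A∩coset∣ k c = sumℕ (λ x → ind (ker x ∧ A k (x ⊕ c)))

  massOnCoset : H n → ℕ
  massOnCoset c = sumℕ (λ h → ind (ker h) * ∣A∣ (h ⊕ c))

  massOnCoset-0H : sumℕ (λ h → ind (ker h) * ∣A∣ h) ≡ massOnCoset 0H
  massOnCoset-0H = sumℕ-cong (λ h → cong (λ k → ind (ker h) * ∣A∣ k) (sym (⊕-identityʳ h)))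

  massOnCoset-t : sumℕ (λ h → ind (not (ker h)) * ∣A∣ h) ≡ massOnCoset t
  massOnCoset-t = sumℕ-complement (λ b h → ind b * ∣A∣ h)

  famCount-fullH : famCount fullH A ≡ massOnCoset 0H + massOnCoset t
  famCount-fullH = begin
    sumℕ ∣A∣                                                             ≡⟨ sumℕ-cong (λ h → sym (ind-*-split (ker h) (∣A∣ h))) ⟩
    sumℕ (λ h → ind (ker h) * ∣A∣ h + ind (not (ker h)) * ∣A∣ h)          ≡⟨ sum-map-+ (λ h → ind (ker h) * ∣A∣ h) _ (allH n) ⟩
    sumℕ (λ h → ind (ker h) * ∣A∣ h) + sumℕ (λ h → ind (not (ker h)) * ∣A∣ h) ≡⟨ cong₂ _+_ massOnCoset-0H massOnCoset-t ⟩
    massOnCoset 0H + massOnCoset t                                       ∎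
    where open ≡-Reasoning

  fourier-numerator : sumℤ (λ x → γ x ℤ.* ℤ.+ ∣A∣ x) ≡ ℤ.+ massOnCoset 0H ℤ.- ℤ.+ massOnCoset t
  fourier-numerator = begin
    sumℤ (λ x → γ x ℤ.* ℤ.+ ∣A∣ x)                                     ≡⟨ sumℤ-cong (λ x → γ*-split x (∣A∣ x)) ⟩
    sumℤ (λ x → ℤ.+ (ind (ker x) * ∣A∣ x) ℤ.- ℤ.+ (ind (not (ker x)) * ∣A∣ x)) ≡⟨ sumℤ-⊖ (λ x → ind (ker x) * ∣A∣ x) _ ⟩
    ℤ.+ sumℕ (λ h → ind (ker h) * ∣A∣ h) ℤ.- ℤ.+ sumℕ (λ h → ind (not (ker h)) * ∣A∣ h)
      ≡⟨ cong₂ (λ p q → ℤ.+ p ℤ.- ℤ.+ q) massOnCoset-0H massOnCoset-t ⟩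
    ℤ.+ massOnCoset 0H ℤ.- ℤ.+ massOnCoset t                           ∎
    where open ≡-Reasoning

  ∣A∣-cosets : ∀ k → ∣A∩coset∣ k 0H + ∣A∩coset∣ k t ≡ ∣A∣ k
  ∣A∣-cosets k = begin
    ∣A∩coset∣ k 0H + ∣A∩coset∣ k t
      ≡⟨ cong₂ _+_ (sumℕ-cong (λ x → cong (λ y → ind (ker x ∧ A k y)) (⊕-identityʳ x)))
                   (sym (sumℕ-complement (λ b x → ind (b ∧ A k x)))) ⟩
    sumℕ (λ x → ind (ker x ∧ A k x)) + sumℕ (λ x → ind (not (ker x) ∧ A k x))
      ≡⟨ sum-map-+ (λ x → ind (ker x ∧ A k x)) _ (allH n) ⟨
    sumℕ (λ x → ind (ker x ∧ A k x) + ind (not (ker x) ∧ A k x))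
      ≡⟨ sumℕ-cong (λ x → ind-∧-split (ker x) (A k x)) ⟩
    ∣A∣ k
      ∎
    where open ≡-Reasoning

  bestShift : H n → H n
  bestShift k = argmax (∣A∩coset∣ k) 0H t

  ∣A∣≤2*best : ∀ k → ∣A∣ k ≤ 2 * ∣A∩coset∣ k (bestShift k)
  ∣A∣≤2*best k = begin
    ∣A∣ k                                              ≡⟨ ∣A∣-cosets k ⟨
    ∣A∩coset∣ k 0H + ∣A∩coset∣ k t                     ≤⟨ +≤2*⊔ (∣A∩coset∣ k 0H) _ ⟩
    2 * (∣A∩coset∣ k 0H ⊔ ∣A∩coset∣ k t)               ≡⟨ cong (2 *_) (argmax-spec (∣A∩coset∣ k) 0H t) ⟨
    2 * ∣A∩coset∣ k (bestShift k)                      ∎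
    where open ≤-Reasoning

  bestCoset : H n
  bestCoset = argmax massOnCoset 0H t

  A' : Family n
  A' h x = A (h ⊕ bestCoset) (x ⊕ bestShift (h ⊕ bestCoset))

  massOnCoset-best≤ : massOnCoset bestCoset ≤ 2 * famCount ker A'
  massOnCoset-best≤ = subst (massOnCoset bestCoset ≤_) (sum-map-* 2 _ (allH n)) (sum-map-mono bound (allH n))
    where
    bound : ∀ h → ind (ker h) * ∣A∣ (h ⊕ bestCoset) ≤ 2 * sumℕ (λ x → ind (ker h ∧ ker x ∧ A' h x))
    bound h with ker h
    ... | true  = ≤-trans (≤-reflexive (+-identityʳ _)) (∣A∣≤2*best (h ⊕ bestCoset))
    ... | false = z≤n

  massOnCosets≤ : massOnCoset 0H ⊔ massOnCoset t ≤ 2 * famCount ker A'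
  massOnCosets≤ = subst (_≤ 2 * famCount ker A') (argmax-spec massOnCoset 0H t) massOnCoset-best≤

  ΛCount-≤ : ΛCount ker A' ≤ ΛCount fullH A
  ΛCount-≤ =
    sumℕ-≤-⊕ bestCoset λ h → sumℕ-≤-⊕ (s h) λ a → sumℕ-≤-⊕ (s h) λ a' → sumℕ-≤-⊕ (s (a ⊕ a' ⊕ h)) λ y →
      begin
        ind (ker h ∧ ker a ∧ ker a' ∧ ker y ∧ A' h a ∧ A' h a' ∧ A' (a ⊕ a' ⊕ h) y)
          ≤⟨ drop (ker h) (ker a) (ker a') (ker y) _ ⟩
        ind (A' h a ∧ A' h a' ∧ A ((a ⊕ a' ⊕ h) ⊕ bestCoset) (y ⊕ s (a ⊕ a' ⊕ h)))
          ≡⟨ cong (λ k → ind (A' h a ∧ A' h a' ∧ A k (y ⊕ s (a ⊕ a' ⊕ h)))) (index h a a') ⟨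
        ind (A' h a ∧ A' h a' ∧ A ((a ⊕ s h) ⊕ (a' ⊕ s h) ⊕ (h ⊕ bestCoset)) (y ⊕ s (a ⊕ a' ⊕ h)))
          ∎
    where
    open ≤-Reasoning
    s : H n → H n
    s h = bestShift (h ⊕ bestCoset)
    drop : ∀ b₁ b₂ b₃ b₄ c → ind (b₁ ∧ b₂ ∧ b₃ ∧ b₄ ∧ c) ≤ ind c
    drop b₁ b₂ b₃ b₄ c = ≤-trans (ind-∧-≤ b₁ _) (≤-trans (ind-∧-≤ b₂ _) (≤-trans (ind-∧-≤ b₃ _) (ind-∧-≤ b₄ c)))
    index : ∀ h a a' → (a ⊕ s h) ⊕ (a' ⊕ s h) ⊕ (h ⊕ bestCoset) ≡ (a ⊕ a' ⊕ h) ⊕ bestCoset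
    index h a a' = trans (cong (_⊕ (h ⊕ bestCoset)) (⊕-translate-cancel a a' (s h))) (sym (⊕-assoc (a ⊕ a') h bestCoset))

  ker-nonZero : NonZero (card ker)
  ker-nonZero = ≢-nonZero λ ∣ker∣≡0 → ≢-nonZero⁻¹ (2 ^ n) {{m^n≢0 2 n}}
    (trans (sym (card-fullH n)) (trans (sym card-index-two) (cong (2 *_) ∣ker∣≡0)))

  Λ-bound : ((ℤ.+ 1) ℚ./ 16) ℚ.* Λ ker A' ℚ.≤ Λ fullH A
  Λ-bound = subst (λ N → ((ℤ.+ 1) ℚ./ 16) ℚ.* Λ ker A' ℚ.≤ (ℤ.+ ΛCount fullH A) /ℚ (N ^ 4)) card-index-two
    (Λ-rescale (card ker) {{ker-nonZero}} ΛCount-≤)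

  density-bound : density fullH A ℚ.+ ℚ.∣ fourierDensity A γ ∣ ℚ.≤ density ker A'
  density-bound = subst₂ (λ d f → d ℚ.+ ℚ.∣ f ∣ ℚ.≤ density ker A') (sym density-fullH) (sym fourierDensity-≡)
    (density-rescale (card ker) {{ker-nonZero}} (m⊔n≤o⇒m≤o (massOnCoset 0H) _ massOnCosets≤) (m⊔n≤o⇒n≤o _ (massOnCoset t) massOnCosets≤))
    where
    density-fullH : density fullH A ≡ (ℤ.+ (massOnCoset 0H + massOnCoset t)) /ℚ ((2 * card ker) ^ 2)
    density-fullH = cong₂ (λ D N → (ℤ.+ D) /ℚ (N ^ 2)) famCount-fullH (sym card-index-two)
    fourierDensity-≡ : fourierDensity A γ ≡ (ℤ.+ massOnCoset 0H ℤ.- ℤ.+ massOnCoset t) /ℚ ((2 * card ker) ^ 2)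
    fourierDensity-≡ = cong₂ (λ z N → z /ℚ (N ^ 2)) fourier-numerator (sym card-index-two)

open import Data.Nat using (ℕ; _*_)
open import Data.Integer using (ℤ; +_)
open import Data.Rational using (ℚ; _≤_; _+_; ∣_∣; _/_)
open import Data.Product using (Σ; _×_)
open import Relation.Binary.PropositionalEquality using (_≡_)

lemma6p3 : (n : ℕ) (A : Family n) (γ : H n → ℤ) → IsCharacter γ → NonTrivial γ →
    Σ (SubsetH n) λ H' → IsSubgroup H' × (2 * card H' ≡ card (fullH {n})) ×
      Σ (Family n) λ A' →
        ((((+ 1) / 16) Data.Rational.* Λ H' A') ≤ Λ fullH A)
        × ((density fullH A + ∣ fourierDensity A γ ∣) ≤ density H' A')
lemma6p3 n A γ χ γ≢1 = ker , ker-isSubgroup , card-index-two , A' , Λ-bound , density-bound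
  where open Construction A γ χ γ≢1
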